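{- Let $a,s,b$ be non-negative integers with $a\le s$. Let $N(a,s,b)$ be the number of matrices with non-negative integer entries and an arbitrary number $r\ge 1$ of rows, $(m_{i,1}\ m_{i,2})_{1\le i\le r}$, such that (1) $m_{1,1}=a$; (2) $m_{1,1}+m_{1,2}=s$; (3) $m_{r,2}=b$; (4) if $r\ge 2$, then $m_{i,1}>m_{j,1}$ and $m_{i,1}+m_{i,2}<m_{j,1}+m_{j,2}$ for all $1\le i<j\le r$. Then $$N(a,s,b)=\begin{cases}0, & \text{if } s-a>b,\\ 1, & \text{if } s-a=b,\\ \sum_{k=0}^{a-1}\binom{b+a-2-s}{k}, & \text{if } s-a<b.\end{cases}$$
   Context: Binomial coefficients follow the convention $\binom{m}{k}=0$ whenever $m<0$ or $k>m$ (with $k\ge 0$), and an empty sum equals $0$. -}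

module Defs where

open import Data.Nat using (ℕ; zero; suc; _+_; _∸_; _<_; _>_)
open import Data.Nat.Properties using (<-cmp)
open import Data.Nat.Combinatorics using (_C_)
open import Data.Integer using (ℤ; +_; -[1+_]) renaming (_-_ to _-ℤ_)
open import Data.Product using (_×_; _,_; proj₁; proj₂)
open import Data.List using (List; []; _∷_; map; upTo)
open import Data.Nat.ListAction using (sum)
open import Data.List.Relation.Unary.AllPairs using (AllPairs)
open import Data.Empty using (⊥)
open import Relation.Binary.PropositionalEquality using (_≡_)
open import Relation.Binary.Definitions using (tri<; tri≈; tri>)

-- A row (m_{i,1}, m_{i,2}); a matrix with r rows is a list of r rows (top to bottom).
Row : Set
Row = ℕ × ℕ

lastRow : Row → List Row → Row
lastRow x [] = x
lastRow x (y ∷ ys) = lastRow y ys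

Before : Row → Row → Set
Before (x₁ , x₂) (y₁ , y₂) = (x₁ > y₁) × (x₁ + x₂ < y₁ + y₂)

Valid : ℕ → ℕ → ℕ → List Row → Set
Valid a s b [] = ⊥
Valid a s b (x ∷ xs) =
  (proj₁ x ≡ a) × (proj₁ x + proj₂ x ≡ s) × (proj₂ (lastRow x xs) ≡ b)
  × AllPairs Before (x ∷ xs)

-- binomial with integer top: binom m k = 0 if m < 0, else m C k (which is 0 if k > m)
binomℤ : ℤ → ℕ → ℕ
binomℤ (+ n) k = n C k
binomℤ -[1+ n ] k = 0

formula : ℕ → ℕ → ℕ → ℕ
formula a s b with <-cmp (s ∸ a) b
... | tri> _ _ _ = 0
... | tri≈ _ _ _ = 1
... | tri< _ _ _ =
  sum (map (λ k → binomℤ ((+ (b + a)) -ℤ (+ (2 + s))) k) (upTo a))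

-- Measure the second column by its deficit D = b − m_{i,2}.  A row (x , b − D) may be
-- followed by (k , b − m) exactly when k < x and x + m < k + D, a condition invariant
-- under shifting x and D together; the last row is the one with deficit 0.  Splitting
-- the possible next rows by whether k = x − 1 shows that the number T(x, D) of
-- admissible continuations of (x , b − D) satisfies T(x, 0) = 1, T(x, 1) = 0 and
-- Pascal's rule T(x + 1, D + 1) = T(x + 1, D) + T(x, D) for D ≥ 2, hence
-- T(x, n + 2) = Σ_{k<x} C(n, k).  The matrices counted by N(a, s, b) are the row
-- (a , s − a) followed by such a continuation, with D = b − (s − a) = b + a − s; there are
-- none when s − a > b, since the second column increases down a matrix.
module Submission where

open import Defs
open import Data.Nat
open import Data.Nat.Properties
open import Data.Nat.Combinatorics using (_C_; nCk+nC[k+1]≡[n+1]C[k+1])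
open import Data.Nat.ListAction using (sum)
open import Data.Nat.ListAction.Properties using (sum-++)
open import Data.Nat.Tactic.RingSolver using (solve-∀)
import Data.Integer as ℤ
open import Data.Integer using (_⊖_)
open import Data.Integer.Properties using ([+m]-[+n]≡m⊖n; +-cancelˡ-⊖)
open import Data.Product using (Σ; ∃-syntax; _×_; _,_; proj₁; proj₂)
open import Data.List using (List; []; _∷_; [_]; _++_; map; length; upTo)
open import Data.List.Properties
  using (∷-injectiveˡ; ∷-injectiveʳ; length-++; length-map; upTo-∷ʳ; map-++)
open import Data.List.Membership.Propositional using (_∈_)
open import Data.List.Membership.Propositional.Properties
  using (∈-map⁺; ∈-map⁻; ∈-++⁺ˡ; ∈-++⁺ʳ; ∈-++⁻)
open import Data.List.Relation.Unary.Any using (here)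
open import Data.List.Relation.Unary.Linked using (Linked; [-]; _∷_)
open import Data.List.Relation.Unary.All using ([])
open import Data.List.Relation.Unary.Linked.Properties using (AllPairs⇒Linked; Linked⇒AllPairs)
open import Data.List.Relation.Unary.Unique.Propositional using (Unique; []; _∷_)
import Data.List.Relation.Unary.Unique.Propositional.Properties as Unique
open import Data.Sum using (inj₁; inj₂)
open import Data.Empty using (⊥)
open import Function.Bundles using (_⇔_; mk⇔; Equivalence)
open import Relation.Nullary using (¬_; yes; no; contradiction)
open import Relation.Binary.Definitions using (Transitive; tri<; tri≈; tri>)
open import Relation.Binary.PropositionalEquality
  using (_≡_; refl; sym; trans; cong; cong₂; subst; subst₂; module ≡-Reasoning)

partialBinomialSum : ℕ → ℕ → ℕ
partialBinomialSum n x = sum (map (n C_) (upTo x))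

sum-map-upTo-suc : ∀ (f : ℕ → ℕ) x → sum (map f (upTo (suc x))) ≡ sum (map f (upTo x)) + f x
sum-map-upTo-suc f x = begin
  sum (map f (upTo (suc x)))           ≡⟨ cong (λ l → sum (map f l)) (sym (upTo-∷ʳ x)) ⟩
  sum (map f (upTo x ++ [ x ]))        ≡⟨ cong sum (map-++ f (upTo x) [ x ]) ⟩
  sum (map f (upTo x) ++ [ f x ])      ≡⟨ sum-++ (map f (upTo x)) [ f x ] ⟩
  sum (map f (upTo x)) + (f x + 0)     ≡⟨ cong (sum (map f (upTo x)) +_) (+-identityʳ (f x)) ⟩
  sum (map f (upTo x)) + f x           ∎
  where open ≡-Reasoning

sum-map-zero : ∀ (xs : List ℕ) → sum (map (λ _ → 0) xs) ≡ 0
sum-map-zero []       = refl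
sum-map-zero (_ ∷ xs) = sum-map-zero xs

partialBinomialSum-zero : ∀ x → partialBinomialSum 0 (suc x) ≡ 1
partialBinomialSum-zero zero    = refl
partialBinomialSum-zero (suc x) =
  trans (sum-map-upTo-suc (0 C_) (suc x)) (cong (_+ 0) (partialBinomialSum-zero x))

partialBinomialSum-pascal : ∀ n x →
  partialBinomialSum (suc n) (suc x) ≡ partialBinomialSum n (suc x) + partialBinomialSum n x
partialBinomialSum-pascal n zero    = refl
partialBinomialSum-pascal n (suc x) = begin
  S (suc n) (suc (suc x))
    ≡⟨ sum-map-upTo-suc (suc n C_) (suc x) ⟩
  S (suc n) (suc x) + suc n C suc x
    ≡⟨ cong₂ _+_ (partialBinomialSum-pascal n x) (sym (nCk+nC[k+1]≡[n+1]C[k+1] n x)) ⟩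
  (S n (suc x) + S n x) + (n C x + n C suc x)
    ≡⟨ interchange (S n (suc x)) (S n x) (n C x) (n C suc x) ⟩
  (S n (suc x) + n C suc x) + (S n x + n C x)
    ≡⟨ cong₂ _+_ (sum-map-upTo-suc (n C_) (suc x)) (sum-map-upTo-suc (n C_) x) ⟨
  S n (suc (suc x)) + S n (suc x)
    ∎
  where
  open ≡-Reasoning
  S : ℕ → ℕ → ℕ
  S = partialBinomialSum
  interchange : ∀ p q r t → (p + q) + (r + t) ≡ (p + t) + (q + r)
  interchange = solve-∀

Before-trans : Transitive Before
Before-trans (y₁<x₁ , x<y) (z₁<y₁ , y<z) = <-trans z₁<y₁ y₁<x₁ , <-trans x<y y<z

Before⇒proj₂< : ∀ {r r′} → Before r r′ → proj₂ r < proj₂ r′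
Before⇒proj₂< {x₁ , x₂} {y₁ , y₂} (y₁<x₁ , x<y) =
  +-cancelˡ-< x₁ x₂ y₂ (<-≤-trans x<y (+-monoˡ-≤ y₂ (<⇒≤ y₁<x₁)))

data Chain (b : ℕ) : Row → List Row → Set where
  end : ∀ {r} → proj₂ r ≡ b → Chain b r []
  _∷_ : ∀ {r r′ xs} → Before r r′ → Chain b r′ xs → Chain b r (r′ ∷ xs)

Chain⇒proj₂≤ : ∀ {b r xs} → Chain b r xs → proj₂ r ≤ b
Chain⇒proj₂≤ (end r₂≡b)  = ≤-reflexive r₂≡b
Chain⇒proj₂≤ (r<r′ ∷ c) = <⇒≤ (<-≤-trans (Before⇒proj₂< r<r′) (Chain⇒proj₂≤ c))

Chain⇒lastRow : ∀ {b r xs} → Chain b r xs → proj₂ (lastRow r xs) ≡ b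
Chain⇒lastRow (end r₂≡b) = r₂≡b
Chain⇒lastRow (_ ∷ c)    = Chain⇒lastRow c

Chain⇒Linked : ∀ {b r xs} → Chain b r xs → Linked Before (r ∷ xs)
Chain⇒Linked (end _)    = [-]
Chain⇒Linked (r<r′ ∷ c) = r<r′ ∷ Chain⇒Linked c

Linked⇒Chain : ∀ {b} r xs → proj₂ (lastRow r xs) ≡ b → Linked Before (r ∷ xs) → Chain b r xs
Linked⇒Chain r []        last≡b _          = end last≡b
Linked⇒Chain r (r′ ∷ xs) last≡b (r<r′ ∷ l) = r<r′ ∷ Linked⇒Chain r′ xs last≡b l

firstRow≡ : ∀ {a s} (r : Row) → proj₁ r ≡ a → proj₁ r + proj₂ r ≡ s → r ≡ (a , s ∸ a)
firstRow≡ (x , y) refl refl = cong (x ,_) (sym (m+n∸m≡n x y))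

Valid⇔Chain : ∀ {a s b r xs} → a ≤ s → Valid a s b (r ∷ xs) ⇔ (r ≡ (a , s ∸ a) × Chain b r xs)
Valid⇔Chain {a} {s} {b} {r} {xs} a≤s = mk⇔ to from
  where
  to : Valid a s b (r ∷ xs) → r ≡ (a , s ∸ a) × Chain b r xs
  to (r₁≡a , r₁+r₂≡s , last≡b , pairs) =
    firstRow≡ r r₁≡a r₁+r₂≡s , Linked⇒Chain r xs last≡b (AllPairs⇒Linked pairs)
  from : r ≡ (a , s ∸ a) × Chain b r xs → Valid a s b (r ∷ xs)
  from (refl , c) =
    refl , m+[n∸m]≡n a≤s , Chain⇒lastRow c , Linked⇒AllPairs Before-trans (Chain⇒Linked c)

<-transport : ∀ {p q p′ q′ t u} → p + t ≡ p′ + u → q + t ≡ q′ + u → p < q → p′ < q′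
<-transport {p} {q} {p′} {q′} {t} {u} p+t≡p′+u q+t≡q′+u p<q =
  +-cancelʳ-< u p′ q′ (subst₂ _<_ p+t≡p′+u q+t≡q′+u (+-monoˡ-< t p<q))

+-deficit : ∀ x m {b D} → D ≤ b → x + (b ∸ D) + (D + m) ≡ x + m + b
+-deficit x m {b} {D} D≤b = begin
  x + (b ∸ D) + (D + m)  ≡⟨ interchange x (b ∸ D) D m ⟩
  x + m + ((b ∸ D) + D)  ≡⟨ cong (x + m +_) (m∸n+n≡m D≤b) ⟩
  x + m + b              ∎
  where
  open ≡-Reasoning
  interchange : ∀ p q r t → p + q + (r + t) ≡ p + t + (q + r)
  interchange = solve-∀

Before⇔deficit : ∀ {b x k D m} → D ≤ b → m ≤ b →
  Before (x , b ∸ D) (k , b ∸ m) ⇔ (k < x × x + m < k + D)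
Before⇔deficit {b} {x} {k} {D} {m} D≤b m≤b = mk⇔
  (λ (k<x , lt) → k<x , <-transport left right lt)
  (λ (k<x , lt) → k<x , <-transport (sym left) (sym right) lt)
  where
  left : x + (b ∸ D) + (D + m) ≡ x + m + b
  left = +-deficit x m D≤b
  right : k + (b ∸ m) + (D + m) ≡ k + D + b
  right = trans (cong (k + (b ∸ m) +_) (+-comm D m)) (+-deficit k D m≤b)

≤⇒∃-deficit : ∀ {b y} → y ≤ b → ∃[ m ] (m ≤ b × y ≡ b ∸ m)
≤⇒∃-deficit {b} {y} y≤b = b ∸ y , m∸n≤m b y , sym (m∸[m∸n]≡n y≤b)

deficit≡0 : ∀ {b} D → D ≤ b → b ∸ D ≡ b → D ≡ 0
deficit≡0 zero    _   _       = refl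
deficit≡0 (suc D) D≤b b∸D≡b = contradiction b∸D≡b (<⇒≢ (∸-monoʳ-< z<s D≤b))

deficit-decreases : ∀ {x k m D} → k < x → x + m < k + D → m < D
deficit-decreases {x} {k} {m} {D} k<x lt =
  +-cancelˡ-< x m D (<-≤-trans lt (+-monoˡ-≤ D (<⇒≤ k<x)))

suc-<-+-suc : ∀ {p q r} → p < q + r → suc p < q + suc r
suc-<-+-suc {p} {q} {r} lt = subst (suc p <_) (sym (+-suc q r)) (s≤s lt)

suc-<-+-suc⁻¹ : ∀ {p q r} → suc p < q + suc r → p < q + r
suc-<-+-suc⁻¹ {p} {q} {r} lt = s≤s⁻¹ (subst (suc p <_) (+-suc q r) lt)

module Chains (b : ℕ) where

  -- chains x D lists the xs with Chain b (x , b ∸ D) xs (for D ≤ b), moves x D the nonempty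
  -- ones.  A next row (k , b ∸ m) with k = x − 1 yields prefixedChains (x − 1) (D − 1); one
  -- with k < x − 1 is, as k < x × x + m < k + D is invariant under shifting x and D
  -- together, a move from (x − 1 , b ∸ (D − 1)).
  mutual
    chains : ℕ → ℕ → List (List Row)
    chains x zero    = [ [] ]
    chains x (suc D) = moves x (suc D)

    moves : ℕ → ℕ → List (List Row)
    moves x       zero    = []
    moves zero    (suc D) = []
    moves (suc x) (suc D) = prefixedChains x D ++ moves x D

    prefixedChains : ℕ → ℕ → List (List Row)
    prefixedChains x zero    = []
    prefixedChains x (suc D) = prefixedChains x D ++ map ((x , b ∸ D) ∷_) (chains x D)

  FirstMove : ℕ → ℕ → List Row → Set
  FirstMove x D xs = ∃[ k ] ∃[ m ] ∃[ rest ]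
    (xs ≡ (k , b ∸ m) ∷ rest × k < x × x + m < k + D × rest ∈ chains k m)

  ∈-prefixedChains⁺ : ∀ {x D m rest} → m < D → rest ∈ chains x m →
    (x , b ∸ m) ∷ rest ∈ prefixedChains x D
  ∈-prefixedChains⁺ {x} {suc D} {m} m<1+D rest∈ with m ≟ D
  ... | yes refl = ∈-++⁺ʳ (prefixedChains x D) (∈-map⁺ _ rest∈)
  ... | no m≢D   = ∈-++⁺ˡ (∈-prefixedChains⁺ (≤∧≢⇒< (s≤s⁻¹ m<1+D) m≢D) rest∈)

  ∈-prefixedChains⁻ : ∀ {x D xs} → xs ∈ prefixedChains x D →
    ∃[ m ] ∃[ rest ] (xs ≡ (x , b ∸ m) ∷ rest × m < D × rest ∈ chains x m)
  ∈-prefixedChains⁻ {x} {suc D} xs∈ with ∈-++⁻ (prefixedChains x D) xs∈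
  ... | inj₁ xs∈′ with ∈-prefixedChains⁻ xs∈′
  ...   | m , rest , xs≡ , m<D , rest∈ = m , rest , xs≡ , m<n⇒m<1+n m<D , rest∈
  ∈-prefixedChains⁻ {x} {suc D} xs∈ | inj₂ xs∈′ with ∈-map⁻ _ xs∈′
  ...   | rest , rest∈ , xs≡ = D , rest , xs≡ , ≤-refl , rest∈

  ∈-moves⁺ : ∀ {x D k m rest} → k < x → x + m < k + D → rest ∈ chains k m →
    (k , b ∸ m) ∷ rest ∈ moves x D
  ∈-moves⁺ {D = zero} k<x lt _ = contradiction (deficit-decreases k<x lt) λ ()
  ∈-moves⁺ {suc x} {suc D} {k} {m} k<1+x lt rest∈ with k ≟ x
  ... | yes refl = ∈-++⁺ˡ (∈-prefixedChains⁺ (+-cancelˡ-< k m D (suc-<-+-suc⁻¹ lt)) rest∈)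
  ... | no k≢x   = ∈-++⁺ʳ (prefixedChains x D)
    (∈-moves⁺ (≤∧≢⇒< (s≤s⁻¹ k<1+x) k≢x) (suc-<-+-suc⁻¹ lt) rest∈)

  ∈-chains⁺ : ∀ {x D k m rest} → k < x → x + m < k + D → rest ∈ chains k m →
    (k , b ∸ m) ∷ rest ∈ chains x D
  ∈-chains⁺ {D = zero}  k<x lt _ = contradiction (deficit-decreases k<x lt) λ ()
  ∈-chains⁺ {D = suc D} k<x lt rest∈ = ∈-moves⁺ k<x lt rest∈

  ∈-moves⁻ : ∀ {x D xs} → xs ∈ moves x D → FirstMove x D xs
  ∈-moves⁻ {suc x} {suc D} xs∈ with ∈-++⁻ (prefixedChains x D) xs∈
  ... | inj₁ xs∈′ with ∈-prefixedChains⁻ xs∈′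
  ...   | m , rest , xs≡ , m<D , rest∈ =
    x , m , rest , xs≡ , ≤-refl , suc-<-+-suc (+-monoʳ-< x m<D) , rest∈
  ∈-moves⁻ {suc x} {suc D} xs∈ | inj₂ xs∈′ with ∈-moves⁻ xs∈′
  ...   | k , m , rest , xs≡ , k<x , lt , rest∈ =
    k , m , rest , xs≡ , m<n⇒m<1+n k<x , suc-<-+-suc lt , rest∈

  chains-sound : ∀ {x D xs} → D ≤ b → xs ∈ chains x D → Chain b (x , b ∸ D) xs
  chains-sound {D = zero} _ (here refl) = end refl
  chains-sound {x} {suc D} D≤b xs∈ with ∈-moves⁻ {x} {suc D} xs∈
  ... | k , m , rest , refl , k<x , lt , rest∈ =
    Equivalence.from (Before⇔deficit D≤b m≤b) (k<x , lt) ∷ chains-sound m≤b rest∈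
    where
    m≤b : m ≤ b
    m≤b = <⇒≤ (<-≤-trans (deficit-decreases k<x lt) D≤b)

  chains-complete : ∀ {x D xs} → D ≤ b → Chain b (x , b ∸ D) xs → xs ∈ chains x D
  chains-complete {D = D} D≤b (end b∸D≡b) with deficit≡0 D D≤b b∸D≡b
  ... | refl = here refl
  chains-complete D≤b (r<r′ ∷ c) with ≤⇒∃-deficit (Chain⇒proj₂≤ c)
  ... | m , m≤b , refl with Equivalence.to (Before⇔deficit D≤b m≤b) r<r′
  ...   | k<x , lt = ∈-chains⁺ k<x lt (chains-complete m≤b c)

  mutual
    chains-unique : ∀ x D → D ≤ b → Unique (chains x D)
    chains-unique x zero    _   = [] ∷ []
    chains-unique x (suc D) D≤b = moves-unique x (suc D) D≤b

    moves-unique : ∀ x D → D ≤ b → Unique (moves x D)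
    moves-unique x       zero    _   = []
    moves-unique zero    (suc D) _   = []
    moves-unique (suc x) (suc D) D≤b =
      Unique.++⁺ (prefixedChains-unique x D (<⇒≤ D≤b)) (moves-unique x D (<⇒≤ D≤b)) disjoint
      where
      disjoint : ∀ {xs} → xs ∈ prefixedChains x D × xs ∈ moves x D → ⊥
      disjoint (p , q) with ∈-prefixedChains⁻ {x} {D} p | ∈-moves⁻ {x} {D} q
      ... | _ , _ , refl , _ | _ , _ , _ , xs≡ , k<x , _ =
        <-irrefl (sym (cong proj₁ (∷-injectiveˡ xs≡))) k<x

    prefixedChains-unique : ∀ x D → D ≤ b → Unique (prefixedChains x D)
    prefixedChains-unique x zero    _   = []
    prefixedChains-unique x (suc D) D≤b =
      Unique.++⁺ (prefixedChains-unique x D (<⇒≤ D≤b))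
                 (Unique.map⁺ ∷-injectiveʳ (chains-unique x D (<⇒≤ D≤b))) disjoint
      where
      disjoint : ∀ {xs} → xs ∈ prefixedChains x D × xs ∈ map ((x , b ∸ D) ∷_) (chains x D) → ⊥
      disjoint (p , q) with ∈-prefixedChains⁻ {x} {D} p | ∈-map⁻ _ q
      ... | _ , _ , refl , m<D , _ | _ , _ , xs≡ =
        <⇒≢ (∸-monoʳ-< m<D (<⇒≤ D≤b)) (sym (cong proj₂ (∷-injectiveˡ xs≡)))

  length-prefixedChains : ∀ x D →
    length (prefixedChains x (suc D)) ≡ length (prefixedChains x D) + length (chains x D)
  length-prefixedChains x D = trans (length-++ (prefixedChains x D))
    (cong (length (prefixedChains x D) +_) (length-map _ (chains x D)))

  length-moves-pascal : ∀ x n →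
    length (moves (suc x) (3 + n)) ≡ length (moves (suc x) (2 + n)) + length (moves x (2 + n))
  length-moves-pascal x n = begin
    length (prefixedChains x (2 + n) ++ moves x (2 + n))
      ≡⟨ length-++ (prefixedChains x (2 + n)) ⟩
    length (prefixedChains x (2 + n)) + length (moves x (2 + n))
      ≡⟨ cong (_+ length (moves x (2 + n))) (length-prefixedChains x (1 + n)) ⟩
    length (prefixedChains x (1 + n)) + length (moves x (1 + n)) + length (moves x (2 + n))
      ≡⟨ cong (_+ length (moves x (2 + n))) (sym (length-++ (prefixedChains x (1 + n)))) ⟩
    length (moves (suc x) (2 + n)) + length (moves x (2 + n))
      ∎
    where open ≡-Reasoning

  length-chains-one : ∀ x → length (chains x 1) ≡ 0
  length-chains-one zero    = refl
  length-chains-one (suc x) = refl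

  length-chains-two : ∀ x → length (chains (suc x) 2) ≡ 1
  length-chains-two zero    = refl
  length-chains-two (suc x) = refl

  length-chains : ∀ x n → length (chains x (2 + n)) ≡ partialBinomialSum n x
  length-chains zero    n       = refl
  length-chains (suc x) zero    = trans (length-chains-two x) (sym (partialBinomialSum-zero x))
  length-chains (suc x) (suc n) = begin
    length (chains (suc x) (3 + n))
      ≡⟨ length-moves-pascal x n ⟩
    length (chains (suc x) (2 + n)) + length (chains x (2 + n))
      ≡⟨ cong₂ _+_ (length-chains (suc x) n) (length-chains x n) ⟩
    partialBinomialSum n (suc x) + partialBinomialSum n x
      ≡⟨ partialBinomialSum-pascal n x ⟨
    partialBinomialSum (suc n) (suc x)
      ∎
    where open ≡-Reasoning

  length-chains-binomℤ : ∀ x D → 0 < D →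
    length (chains x D) ≡ sum (map (binomℤ (D ⊖ 2)) (upTo x))
  length-chains-binomℤ x 1             _ = trans (length-chains-one x) (sym (sum-map-zero (upTo x)))
  length-chains-binomℤ x (suc (suc n)) _ = length-chains x n

open Chains using (chains; chains-sound; chains-complete; chains-unique; length-chains-binomℤ)

binomialTop : ∀ {a s b} → a ≤ s → s ∸ a ≤ b →
  ℤ.+ (b + a) ℤ.- ℤ.+ (2 + s) ≡ (b ∸ (s ∸ a)) ⊖ 2
binomialTop {a} {s} {b} a≤s s∸a≤b = begin
  ℤ.+ (b + a) ℤ.- ℤ.+ (2 + s) ≡⟨ [+m]-[+n]≡m⊖n (b + a) (2 + s) ⟩
  (b + a) ⊖ (2 + s)           ≡⟨ cong₂ _⊖_ b+a≡s+D (+-comm 2 s) ⟩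
  (s + D) ⊖ (s + 2)           ≡⟨ +-cancelˡ-⊖ s D 2 ⟩
  D ⊖ 2                       ∎
  where
  open ≡-Reasoning
  D : ℕ
  D = b ∸ (s ∸ a)
  b+a≡s+D : b + a ≡ s + D
  b+a≡s+D = begin
    b + a                 ≡⟨ cong (_+ a) (sym (m∸n+n≡m s∸a≤b)) ⟩
    D + (s ∸ a) + a       ≡⟨ +-assoc D (s ∸ a) a ⟩
    D + (s ∸ a + a)       ≡⟨ cong (D +_) (m∸n+n≡m a≤s) ⟩
    D + s                 ≡⟨ +-comm D s ⟩
    s + D                 ∎

admissible : ℕ → ℕ → ℕ → List (List Row)
admissible a s b = map ((a , s ∸ a) ∷_) (chains b a (b ∸ (s ∸ a)))

length-admissible : ∀ a s b → length (admissible a s b) ≡ length (chains b a (b ∸ (s ∸ a)))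
length-admissible a s b = length-map _ (chains b a (b ∸ (s ∸ a)))

admissible-unique : ∀ a s b → Unique (admissible a s b)
admissible-unique a s b =
  Unique.map⁺ ∷-injectiveʳ (chains-unique b a (b ∸ (s ∸ a)) (m∸n≤m b (s ∸ a)))

∈-admissible⇔ : ∀ {a s b} → a ≤ s → s ∸ a ≤ b →
  (m : List Row) → m ∈ admissible a s b ⇔ Valid a s b m
∈-admissible⇔ {a} {s} {b} a≤s s∸a≤b = λ m → mk⇔ (to m) (from m)
  where
  D : ℕ
  D = b ∸ (s ∸ a)
  firstRow : (a , b ∸ D) ≡ (a , s ∸ a)
  firstRow = cong (a ,_) (m∸[m∸n]≡n s∸a≤b)
  to : ∀ m → m ∈ admissible a s b → Valid a s b m
  to m m∈ with ∈-map⁻ _ m∈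
  ... | xs , xs∈ , refl = Equivalence.from (Valid⇔Chain a≤s)
    (refl , subst (λ r → Chain b r xs) firstRow (chains-sound b (m∸n≤m b (s ∸ a)) xs∈))
  from : ∀ m → Valid a s b m → m ∈ admissible a s b
  from (r ∷ xs) v with Equivalence.to (Valid⇔Chain a≤s) v
  ... | refl , c =
    ∈-map⁺ _ (chains-complete b (m∸n≤m b (s ∸ a)) (subst (λ r → Chain b r xs) (sym firstRow) c))

¬Valid : ∀ {a s b} → a ≤ s → b < s ∸ a → (m : List Row) → ¬ Valid a s b m
¬Valid a≤s b<s∸a (r ∷ xs) v with Equivalence.to (Valid⇔Chain a≤s) v
... | refl , c = <⇒≱ b<s∸a (Chain⇒proj₂≤ c)

lemma1 : (a s b : ℕ) → a ≤ s →
    Σ (List (List Row)) (λ ms →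
      Unique ms × ((m : List Row) → (m ∈ ms ⇔ Valid a s b m))
      × length ms ≡ formula a s b)
lemma1 a s b a≤s with <-cmp (s ∸ a) b
... | tri> _ _ b<s∸a =
  [] , [] , (λ m → mk⇔ (λ ()) (λ v → contradiction v (¬Valid a≤s b<s∸a m))) , refl
... | tri≈ _ s∸a≡b _ =
  admissible a s b , admissible-unique a s b , ∈-admissible⇔ a≤s (≤-reflexive s∸a≡b) ,
  trans (length-admissible a s b)
        (cong (λ D → length (chains b a D)) (trans (cong (b ∸_) s∸a≡b) (n∸n≡0 b)))
... | tri< s∸a<b _ _ =
  admissible a s b , admissible-unique a s b , ∈-admissible⇔ a≤s (<⇒≤ s∸a<b) ,
  trans (length-admissible a s b)
        (trans (length-chains-binomℤ b a (b ∸ (s ∸ a)) (m<n⇒0<n∸m s∸a<b))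
               (cong (λ z → sum (map (binomℤ z) (upTo a))) (sym (binomialTop a≤s (<⇒≤ s∸a<b)))))
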